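{- Let $G$ be a permutation graph on vertex set $\{1,\ldots,n\}$ with respect to a permutation $\sigma$, let $s,t$ be vertices, and let $P=(s=v_1,v_2,\ldots,v_l=t)$ be an $s$–$t$ shortest path in $G$. Then for every $2\leq i\leq l-1$, the edges $(v_{i-1},v_i)$ and $(v_i,v_{i+1})$ are of different types.
   Context: A graph $G$ on vertices $\{1,\ldots,n\}$ is a permutation graph with respect to $\sigma\in S_n$ if for all $1\leq i<j\leq n$, $(i,j)\in E(G)$ iff $\sigma(i)>\sigma(j)$. For an edge $(v_i,v_{i+1})$ of an $s$–$t$ shortest path $(v_1,\ldots,v_l)$, it is of L-type if $v_{i+1}<v_i$ and of R-type if $v_i<v_{i+1}$ (comparison of vertex labels as integers). -}

module Defs where

open import Data.Nat using (ℕ; zero; suc; _≤_)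
open import Data.Fin using (Fin; zero; suc; fromℕ; inject₁; _<_; _>_)
open import Data.Fin.Permutation using (Permutation′; _⟨$⟩ʳ_)
open import Data.Product using (_×_)
open import Data.Sum using (_⊎_)
open import Relation.Binary.PropositionalEquality using (_≡_)

-- Vertices {1,…,n} are represented by Fin n (label i+1 ↦ i; order preserved).
-- Edge relation of the permutation graph of σ:
-- for i < j, (i,j) is an edge iff σ(i) > σ(j); the graph is undirected.
Adj : {n : ℕ} → Permutation′ n → Fin n → Fin n → Set
Adj σ u v = (u < v × (σ ⟨$⟩ʳ u) > (σ ⟨$⟩ʳ v)) ⊎ (v < u × (σ ⟨$⟩ʳ v) > (σ ⟨$⟩ʳ u))

IsWalk : {n : ℕ} → Permutation′ n → (k : ℕ) → (Fin (suc k) → Fin n) → Set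
IsWalk σ k w = (i : Fin k) → Adj σ (w (inject₁ i)) (w (suc i))

IsSTWalk : {n : ℕ} → Permutation′ n → Fin n → Fin n → (k : ℕ) → (Fin (suc k) → Fin n) → Set
IsSTWalk σ s t k w = w zero ≡ s × w (fromℕ k) ≡ t × IsWalk σ k w

-- An s–t shortest path: an s–t walk with k edges such that every s–t walk has ≥ k edges.
-- (Minimality forces the vertices to be distinct, so it is a path.)
IsShortestPath : {n : ℕ} → Permutation′ n → Fin n → Fin n → (k : ℕ) → (Fin (suc k) → Fin n) → Set
IsShortestPath {n} σ s t k w =
  IsSTWalk σ s t k w ×
  ((m : ℕ) (w′ : Fin (suc m) → Fin n) → IsSTWalk σ s t m w′ → k ≤ m)

LType : {n : ℕ} → Fin n → Fin n → Set
LType a b = b < a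

RType : {n : ℕ} → Fin n → Fin n → Set
RType a b = a < b

DifferentTypes : {n : ℕ} → Fin n → Fin n → Fin n → Set
DifferentTypes a b c = (LType a b × RType b c) ⊎ (RType a b × LType b c)

{-# OPTIONS --safe #-}
module Submission where

-- Inversions of σ compose: if a < b < c with σ a > σ b > σ c, then also
-- σ a > σ c.  So two consecutive path edges of the same type, (a,b) and
-- (b,c), force the chord (a,c), and skipping b gives an s–t walk with one
-- edge fewer, contradicting minimality.

open import Defs
open import Data.Nat using (ℕ; suc)
open import Data.Fin using (Fin; inject₁; suc; zero; fromℕ; _<_)
open import Data.Fin.Permutation using (Permutation′; _⟨$⟩ʳ_)
open import Data.Fin.Properties using (<-trans)
open import Data.Nat.Properties using (n≮n)
open import Data.Product using (Σ-syntax; _×_; _,_)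
open import Data.Sum using (inj₁; inj₂; swap)
open import Relation.Nullary using (¬_; contradiction)
open import Relation.Binary.PropositionalEquality using (_≡_; refl; subst; sym; trans)

module _ {n : ℕ} (σ : Permutation′ n) where

  Adj-sym : ∀ {u v : Fin n} → Adj σ u v → Adj σ v u
  Adj-sym = swap

  inversion-trans : ∀ {a b c : Fin n} → a < b → b < c →
    σ ⟨$⟩ʳ b < σ ⟨$⟩ʳ a → σ ⟨$⟩ʳ c < σ ⟨$⟩ʳ b → Adj σ a c
  inversion-trans a<b b<c σb<σa σc<σb = inj₁ (<-trans a<b b<c , <-trans σc<σb σb<σa)

  walk-skip : (m : ℕ) (w : Fin (suc (suc m)) → Fin n) → IsWalk σ (suc m) w →
    (i : Fin m) → Adj σ (w (inject₁ (inject₁ i))) (w (suc (suc i))) →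
    Σ[ w′ ∈ (Fin (suc m) → Fin n) ]
      IsWalk σ m w′ × w′ zero ≡ w zero × w′ (fromℕ m) ≡ w (fromℕ (suc m))
  walk-skip (suc m) w walk zero chord = w′ , walk′ , refl , refl
    where
    w′ : Fin (suc (suc m)) → Fin n
    w′ zero    = w zero
    w′ (suc j) = w (suc (suc j))
    walk′ : IsWalk σ (suc m) w′
    walk′ zero    = chord
    walk′ (suc j) = walk (suc (suc j))
  walk-skip (suc m) w walk (suc i) chord
    with walk-skip m (λ j → w (suc j)) (λ j → walk (suc j)) i chord
  ... | v , walkᵥ , v₀≡w₁ , vₘ≡wₘ = w′ , walk′ , refl , vₘ≡wₘ
    where
    w′ : Fin (suc (suc m)) → Fin n
    w′ zero    = w zero
    w′ (suc j) = v j
    walk′ : IsWalk σ (suc m) w′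
    walk′ zero    = subst (Adj σ (w zero)) (sym v₀≡w₁) (walk zero)
    walk′ (suc j) = walkᵥ j

  shortestPath-chordless : ∀ {s t : Fin n} {m : ℕ} (w : Fin (suc (suc m)) → Fin n) →
    IsShortestPath σ s t (suc m) w → (i : Fin m) →
    ¬ Adj σ (w (inject₁ (inject₁ i))) (w (suc (suc i)))
  shortestPath-chordless {m = m} w ((w₀≡s , wₗ≡t , walk) , minimal) i chord
    with walk-skip m w walk i chord
  ... | w′ , walk′ , w′₀≡w₀ , w′ₗ≡wₗ =
    n≮n m (minimal m w′ (trans w′₀≡w₀ w₀≡s , trans w′ₗ≡wₗ wₗ≡t , walk′))

mainTheorem12 : (n : ℕ) (σ : Permutation′ n) (s t : Fin n) (k : ℕ)
    (w : Fin (suc (suc k)) → Fin n) → IsShortestPath σ s t (suc k) w →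
    (i : Fin k) →
    DifferentTypes (w (inject₁ (inject₁ i))) (w (suc (inject₁ i))) (w (suc (suc i)))
mainTheorem12 n σ s t k w shortest@((_ , _ , walk) , _) i
  with walk (inject₁ i) | walk (suc i)
... | inj₁ (a<b , _)     | inj₂ (c<b , _)     = inj₂ (a<b , c<b)
... | inj₂ (b<a , _)     | inj₁ (b<c , _)     = inj₁ (b<a , b<c)
... | inj₁ (a<b , σb<σa) | inj₁ (b<c , σc<σb) =
  contradiction (inversion-trans σ a<b b<c σb<σa σc<σb) (shortestPath-chordless σ w shortest i)
... | inj₂ (b<a , σa<σb) | inj₂ (c<b , σb<σc) =
  contradiction (Adj-sym σ (inversion-trans σ c<b b<a σb<σc σa<σb)) (shortestPath-chordless σ w shortest i)
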